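{- Let $\mathfrak{S} = \langle S; \to_1, \to_2\rangle$ be an arena whose configuration set $S$ is partitioned into $V_1$ (Player 1) and $V_2$ (Player 2), with $I_0 \subseteq S$ a set of initial and $F \subseteq S$ a set of final configurations, and suppose that $\mathfrak{S}$ is $\to^*$-image-finite and satisfies assumptions (A0)–(A2) below. Then Player 2 has a winning strategy (reaching $F$) from every configuration in $post_{\to^*}(I_0) \cap V_1$ if and only if there exist a set $A \subseteq S$ and a binary relation $\prec \subseteq S \times S$ such that: (L1) $I_0 \subseteq A$; (L2) for all $x, y \in S$, if $x \in A$ and ($x \to_1 y$ or $x \to_2 y$), then $y \in A$; (L3) $\prec$ is a strict preorder on $S$; (L4) for all $x \in A \setminus F$ and $y \in S \setminus F$ with $x \to_1 y$, there exists $z \in A$ with $y \to_2 z$ and $z \prec x$.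
   Context: An arena is a transition system $\langle S; \to_1, \to_2\rangle$ where $S$ is partitioned into disjoint sets $V_1, V_2$ with $pre_{\to_i}(S) \subseteq V_i$ for $i=1,2$ (moves of Player $i$ start in $V_i$); $\to = \to_1 \cup \to_2$, $\to^*$ is its reflexive-transitive closure, $pre_{R}(X)=\{p : \exists q\in X,\, p R q\}$ and $post_{R}(X)=\{q:\exists p\in X,\, pRq\}$. The arena is $\to^*$-image-finite if $post_{\to^*}(\{s\})$ is finite for every $s \in S$. Assumptions: (A0) strict alternation: $post_{\to_i}(S) \cap V_i = \emptyset$ for $i=1,2$; (A1) $I_0, F \subseteq V_1$; (A2) every non-final configuration $x \in S\setminus F$ has some $y$ with $x \to_1 y$ or $x \to_2 y$. A strategy for Player $i$ is a partial function $f : S^* V_i \to S$ such that whenever $vp$ is a path and $p \in V_i$ is not a dead end, $p \to_i f(vp)$. Strategies of both players from a start configuration $s_0$ determine a unique (finite or infinite) path; Player 2 wins iff the path visits $F$, or the path is finite and its last configuration belongs to Player 1; otherwise Player 1 wins. A strategy for Player 2 is winning from a set of configurations if against every strategy of Player 1 the resulting path from each configuration in the set is a win for Player 2. A strict preorder is an irreflexive transitive relation. -}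

module Defs where

open import Data.Nat using (ℕ; zero; suc; _<_; _≤_)
open import Data.List using (List; []; _∷_; _++_; [_]; map; upTo)
open import Data.List.Membership.Propositional using (_∈_)
open import Data.Product using (Σ; ∃; _×_; _,_)
open import Data.Sum using (_⊎_)
open import Relation.Nullary using (¬_)
open import Relation.Binary.PropositionalEquality using (_≡_; _≢_)
open import Relation.Binary.Construct.Closure.ReflexiveTransitive using (Star)

data Player : Set where
  P1 P2 : Player

-- An arena ⟨S; →₁, →₂⟩.  The partition S = V₁ ⊎ V₂ is given by the owner
-- function (V_i = { s | owner s ≡ i }), and moves of Player i start in V_i.
record Arena : Set₁ where
  field
    S     : Set
    owner : S → Player
    _⟶₁_  : S → S → Set
    _⟶₂_  : S → S → Set
    pre₁  : ∀ {x y} → x ⟶₁ y → owner x ≡ P1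
    pre₂  : ∀ {x y} → x ⟶₂ y → owner x ≡ P2

module Game (G : Arena) (I₀ F : Arena.S G → Set) where
  open Arena G public

  V₁ V₂ : S → Set
  V₁ s = owner s ≡ P1
  V₂ s = owner s ≡ P2

  _⟶_ : S → S → Set
  x ⟶ y = (x ⟶₁ y) ⊎ (x ⟶₂ y)

  _⟶*_ : S → S → Set
  _⟶*_ = Star _⟶_

  Move : Player → S → S → Set
  Move P1 = _⟶₁_
  Move P2 = _⟶₂_

  PostStarI₀ : S → Set
  PostStarI₀ s = ∃ λ i → I₀ i × (i ⟶* s)

  -- →*-image-finite: post_{→*}({s}) is finite, i.e. covered by a finite list
  ImageFinite : Set
  ImageFinite = ∀ s → ∃ λ (xs : List S) → ∀ t → s ⟶* t → t ∈ xs

  A0 : Set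
  A0 = (∀ {x y} → x ⟶₁ y → owner y ≢ P1) × (∀ {x y} → x ⟶₂ y → owner y ≢ P2)

  A1 : Set
  A1 = (∀ s → I₀ s → V₁ s) × (∀ s → F s → V₁ s)

  A2 : Set
  A2 = ∀ x → ¬ F x → ∃ λ y → x ⟶ y

  DeadEnd : S → Set
  DeadEnd p = ¬ (∃ λ q → p ⟶ q)

  data IsPath : List S → Set where
    nil  : IsPath []
    one  : ∀ x → IsPath (x ∷ [])
    cons : ∀ {x y r} → x ⟶ y → IsPath (y ∷ r) → IsPath (x ∷ y ∷ r)

  -- A strategy of Player i: a partial function S* V_i → S, represented by a
  -- total function on histories (h , p) ~ h p, whose values matter only where
  -- h p is a path, p ∈ V_i and p is not a dead end; there it must be a legal
  -- move of Player i.
  record Strategy (i : Player) : Set where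
    field
      move  : List S → S → S
      legal : ∀ h p → owner p ≡ i → IsPath (h ++ [ p ]) → ¬ DeadEnd p →
              Move i p (move h p)
  open Strategy public

  next : Strategy P1 → Strategy P2 → List S → S → S
  next σ₁ σ₂ h p with owner p
  ... | P1 = move σ₁ h p
  ... | P2 = move σ₂ h p

  hist : (ℕ → S) → ℕ → List S
  hist π n = map π (upTo n)

  -- Infinite paths are π : ℕ → S; finite
  -- paths are π restricted to indices ≤ k (k = index of the last configuration).
  InfinitePlay : S → Strategy P1 → Strategy P2 → (ℕ → S) → Set
  InfinitePlay s₀ σ₁ σ₂ π =
    π 0 ≡ s₀ ×
    (∀ n → ¬ DeadEnd (π n) × π (suc n) ≡ next σ₁ σ₂ (hist π n) (π n))

  FinitePlay : S → Strategy P1 → Strategy P2 → (ℕ → S) → ℕ → Set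
  FinitePlay s₀ σ₁ σ₂ π k =
    π 0 ≡ s₀ ×
    (∀ n → n < k → ¬ DeadEnd (π n) × π (suc n) ≡ next σ₁ σ₂ (hist π n) (π n)) ×
    DeadEnd (π k)

  WinningFrom₂ : Strategy P2 → (S → Set) → Set
  WinningFrom₂ σ₂ X =
    ∀ s₀ → X s₀ → (σ₁ : Strategy P1) →
      (∀ π → InfinitePlay s₀ σ₁ σ₂ π → ∃ λ n → F (π n)) ×
      (∀ π k → FinitePlay s₀ σ₁ σ₂ π k →
         (∃ λ n → n ≤ k × F (π n)) ⊎ V₁ (π k))

  HasWinningStrategy₂ : (S → Set) → Set
  HasWinningStrategy₂ X = ∃ λ (σ₂ : Strategy P2) → WinningFrom₂ σ₂ X

-- Sufficiency (L1–L4 ⇒ win): Player 2 moves into A to a configuration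
-- ≺-below the previous Player-1 configuration.  Along an infinite play missing
-- F the Player-1 positions then form a ≺-descending sequence in the finite set
-- post→*(s₀), which is impossible; finite plays end in dead ends, which are
-- final by (A2).
--
-- Necessity (win ⇒ L1–L4): take A = post→*(I₀) and z ≺ x iff z lies in a
-- strictly lower level of Player 2's attractor of F than x.  That winning
-- configurations lie in the attractor is shown by the converse: outside the
-- attractor Player 1 can stay outside forever, using image-finiteness to
-- bound the levels of the finitely many successors of its configurations.
module Submission where

open import Defs
open import Axiom.ExcludedMiddle using (ExcludedMiddle)
open import Axiom.DoubleNegationElimination using (em⇒dne)
open import Level using (0ℓ)
open import Data.Empty using (⊥; ⊥-elim)
open import Data.Unit using (⊤; tt)
open import Data.Product using (Σ; ∃; _×_; _,_; proj₁; proj₂)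
open import Data.Sum using (_⊎_; inj₁; inj₂)
open import Data.Nat using (ℕ; zero; suc; _<_; _≤_; z≤n; s≤s; _≤?_; _⊔_)
open import Data.Nat.Properties
  using (<⇒≤; ≰⇒>; m≤n⇒m<n∨m≡n; m≤m⊔n; m≤n⊔m; n<1+n; m<1+n⇒m≤n; m<n⇒m<1+n; ≤-refl)
open import Data.Nat.Induction using (<-rec)
open import Data.List using (List; []; _∷_; _++_; [_]; map; upTo; length; lookup)
open import Data.List.Properties using (map-++; upTo-∷ʳ)
open import Data.List.Membership.Propositional using (_∈_)
open import Data.List.Relation.Unary.Any using (here; there; index)
open import Data.List.Relation.Unary.Any.Properties using (lookup-index)
open import Data.Fin using (toℕ)
open import Data.Fin.Properties using (pigeonhole)
open import Relation.Nullary using (¬_; yes; no)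
open import Relation.Binary.PropositionalEquality
  using (_≡_; _≢_; refl; sym; trans; cong; subst; subst₂)
open import Relation.Binary.Definitions using (Irreflexive; Transitive)
open import Relation.Binary.Construct.Closure.ReflexiveTransitive using (ε; _◅_; _◅◅_)
open import Function.Bundles using (_⇔_; mk⇔)

choose : ExcludedMiddle 0ℓ → {A : Set} → (A → Set) → A → A
choose lem P d with lem {∃ P}
... | yes (z , _) = z
... | no _ = d

choose-elim : (lem : ExcludedMiddle 0ℓ) {A : Set} (P : A → Set) (d : A) (Q : A → Set) →
  (∀ z → P z → Q z) → (¬ ∃ P → Q d) → Q (choose lem P d)
choose-elim lem P d Q onWitness onDefault with lem {∃ P}
... | yes (z , pz) = onWitness z pz
... | no none = onDefault none

least-witness : ExcludedMiddle 0ℓ → (P : ℕ → Set) → ∀ n → P n →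
  ∃ λ m → P m × (∀ k → k < m → ¬ P k)
least-witness lem P = <-rec (λ n → P n → ∃ λ m → P m × (∀ k → k < m → ¬ P k)) search
  where
  search : ∀ n → (∀ {k} → k < n → P k → ∃ λ m → P m × (∀ k → k < m → ¬ P k)) →
    P n → ∃ λ m → P m × (∀ k → k < m → ¬ P k)
  search n below pn with lem {∃ λ k → k < n × P k}
  ... | yes (k , k<n , pk) = below k<n pk
  ... | no none = n , pn , λ k k<n pk → none (k , k<n , pk)

-- A strict preorder has no infinite descending sequence inside a finite list:
-- by pigeonhole two positions coincide, contradicting irreflexivity.
no-descent-in-finite : {X : Set} {_≺_ : X → X → Set} →
  Irreflexive _≡_ _≺_ → Transitive _≺_ →
  (xs : List X) (x : ℕ → X) → (∀ k → x k ∈ xs) → (∀ k → x (suc k) ≺ x k) → ⊥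
no-descent-in-finite {_≺_ = _≺_} irr tr xs x inside descends
  with pigeonhole (n<1+n (length xs)) (λ i → index (inside (toℕ i)))
... | i , j , i<j , sameIndex = irr (sym xᵢ≡xⱼ) (descending i<j)
  where
  descending : ∀ {a b} → a < b → x b ≺ x a
  descending {a} {suc b} a<1+b with m≤n⇒m<n∨m≡n (m<1+n⇒m≤n a<1+b)
  ... | inj₁ a<b = tr (descends b) (descending a<b)
  ... | inj₂ refl = descends b

  xᵢ≡xⱼ : x (toℕ i) ≡ x (toℕ j)
  xᵢ≡xⱼ = trans (lookup-index (inside (toℕ i)))
            (trans (cong (lookup xs) sameIndex) (sym (lookup-index (inside (toℕ j)))))

P1≢P2 : P1 ≢ P2
P1≢P2 ()

≢P1⇒≡P2 : ∀ {i} → i ≢ P1 → i ≡ P2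
≢P1⇒≡P2 {P1} i≢P1 = ⊥-elim (i≢P1 refl)
≢P1⇒≡P2 {P2} _ = refl

≢P2⇒≡P1 : ∀ {i} → i ≢ P2 → i ≡ P1
≢P2⇒≡P1 {P1} _ = refl
≢P2⇒≡P1 {P2} i≢P2 = ⊥-elim (i≢P2 refl)

lastOr : {A : Set} → A → List A → A
lastOr d [] = d
lastOr d (x ∷ xs) = lastOr x xs

lastOr-snoc : {A : Set} (d : A) (l : List A) (a : A) → lastOr d (l ++ [ a ]) ≡ a
lastOr-snoc d [] a = refl
lastOr-snoc d (x ∷ l) a = lastOr-snoc x l a

module Theory (lem : ExcludedMiddle 0ℓ) (G : Arena) (I₀ F : Arena.S G → Set) where
  open Game G I₀ F

  WinsReachable : Set
  WinsReachable = HasWinningStrategy₂ (λ s → PostStarI₀ s × V₁ s)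

  classical : (P : Set) → ¬ ¬ P → P
  classical P = em⇒dne lem

  owned-move : ∀ {x y} i → owner x ≡ i → x ⟶ y → Move i x y
  owned-move P1 _ (inj₁ m) = m
  owned-move P1 own (inj₂ m) = ⊥-elim (P1≢P2 (trans (sym own) (pre₂ m)))
  owned-move P2 own (inj₁ m) = ⊥-elim (P1≢P2 (trans (sym (pre₁ m)) own))
  owned-move P2 _ (inj₂ m) = m

  owner-cases : ∀ p → V₁ p ⊎ V₂ p
  owner-cases p with owner p
  ... | P1 = inj₁ refl
  ... | P2 = inj₂ refl

  star-closed : (A : S → Set) → (∀ x y → A x → x ⟶ y → A y) → ∀ {x y} → A x → x ⟶* y → A y
  star-closed A closed ax ε = ax
  star-closed A closed ax (m ◅ ms) = star-closed A closed (closed _ _ ax m) ms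

  post-closed : ∀ x y → PostStarI₀ x → x ⟶ y → PostStarI₀ y
  post-closed x y (i , i∈I₀ , i⟶*x) m = i , i∈I₀ , (i⟶*x ◅◅ (m ◅ ε))

  hist-suc : (π : ℕ → S) (n : ℕ) → hist π (suc n) ≡ hist π n ++ [ π n ]
  hist-suc π n = trans (cong (map π) (sym (upTo-∷ʳ n))) (map-++ π (upTo n) [ n ])

  path-snoc : ∀ l {a b} → IsPath (l ++ [ a ]) → a ⟶ b → IsPath ((l ++ [ a ]) ++ [ b ])
  path-snoc [] _ m = cons m (one _)
  path-snoc (x ∷ []) (cons m′ p) m = cons m′ (path-snoc [] p m)
  path-snoc (x ∷ y ∷ l) (cons m′ p) m = cons m′ (path-snoc (y ∷ l) p m)

  next-legal : (σ₁ : Strategy P1) (σ₂ : Strategy P2) → ∀ h p →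
    IsPath (h ++ [ p ]) → ¬ DeadEnd p → p ⟶ next σ₁ σ₂ h p
  next-legal σ₁ σ₂ h p path live with owner p in own
  ... | P1 = inj₁ (legal σ₁ h p own path live)
  ... | P2 = inj₂ (legal σ₂ h p own path live)

  next-P1 : (σ₁ : Strategy P1) (σ₂ : Strategy P2) → ∀ h p → owner p ≡ P1 →
    next σ₁ σ₂ h p ≡ move σ₁ h p
  next-P1 σ₁ σ₂ h p own rewrite own = refl

  next-P2 : (σ₁ : Strategy P1) (σ₂ : Strategy P2) → ∀ h p → owner p ≡ P2 →
    next σ₁ σ₂ h p ≡ move σ₂ h p
  next-P2 σ₁ σ₂ h p own rewrite own = refl

  module Follow (σ₁ : Strategy P1) (σ₂ : Strategy P2) (π : ℕ → S)
    (follows : ∀ n → π (suc n) ≡ next σ₁ σ₂ (hist π n) (π n)) where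

    Prefix : ℕ → Set
    Prefix n = IsPath (hist π n ++ [ π n ])

    step : ∀ n → Prefix n → ¬ DeadEnd (π n) → π n ⟶ π (suc n)
    step n path live = subst (π n ⟶_) (sym (follows n)) (next-legal σ₁ σ₂ _ _ path live)

    extend : ∀ n → Prefix n → π n ⟶ π (suc n) → Prefix (suc n)
    extend n path m =
      subst (λ h → IsPath (h ++ [ π (suc n) ])) (sym (hist-suc π n)) (path-snoc (hist π n) path m)

    along : (Inv : ℕ → Set) → (∀ n → Inv n → ¬ DeadEnd (π n)) →
      (∀ n → Inv n → π n ⟶ π (suc n) → Inv (suc n)) → Inv 0 →
      ∀ n → Inv n × Prefix n
    along Inv live keep inv₀ zero = inv₀ , one (π 0)
    along Inv live keep inv₀ (suc n) with along Inv live keep inv₀ n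
    ... | inv , path = keep n inv m , extend n path m
      where
      m : π n ⟶ π (suc n)
      m = step n path (live n inv)

  preferred : (i : Player) → (List S → S → S → Set) → List S → S → S
  preferred i Good h p = choose lem (λ z → Move i p z × Good h p z) (choose lem (Move i p) p)

  preferring : (i : Player) → (List S → S → S → Set) → Strategy i
  preferring i Good = record { move = preferred i Good ; legal = preferred-legal }
    where
    preferred-legal : ∀ h p → owner p ≡ i → IsPath (h ++ [ p ]) → ¬ DeadEnd p →
      Move i p (preferred i Good h p)
    preferred-legal h p own _ live =
      choose-elim lem (λ z → Move i p z × Good h p z) (choose lem (Move i p) p) (Move i p) (λ _ → proj₁)
        (λ _ → choose-elim lem (Move i p) p (Move i p) (λ _ m → m)
          (λ none → ⊥-elim (live (λ { (q , m) → none (q , owned-move i own m) }))))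

  preferred-good : ∀ i (Good : List S → S → S → Set) h p → (∃ λ z → Move i p z × Good h p z) →
    Good h p (preferred i Good h p)
  preferred-good i Good h p good =
    choose-elim lem (λ z → Move i p z × Good h p z) (choose lem (Move i p) p) (Good h p)
      (λ _ → proj₂) (λ none → ⊥-elim (none good))

  -- By (A2) a finite play ends in a final configuration, so Player 2 wins it.
  finite-plays-won : A2 → ∀ {s₀ σ₁ σ₂} π k → FinitePlay s₀ σ₁ σ₂ π k →
    (∃ λ n → n ≤ k × F (π n)) ⊎ V₁ (π k)
  finite-plays-won a2 π k (_ , _ , dead) =
    inj₁ (k , ≤-refl , classical _ (λ notF → dead (a2 (π k) notF)))

  module Sufficiency (fin : ImageFinite) (a0 : A0) (a2 : A2)
    (A : S → Set) (_≺_ : S → S → Set)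
    (L1 : ∀ s → I₀ s → A s)
    (L2 : ∀ x y → A x → (x ⟶₁ y) ⊎ (x ⟶₂ y) → A y)
    (irr : Irreflexive _≡_ _≺_) (tr : Transitive _≺_)
    (L4 : ∀ x y → A x → ¬ F x → ¬ F y → x ⟶₁ y → ∃ λ z → A z × (y ⟶₂ z) × (z ≺ x)) where

    -- Player 2 moves into A, below the configuration Player 1 just left.
    Descend : List S → S → S → Set
    Descend h p z = A z × (z ≺ lastOr p h)

    σ₂ : Strategy P2
    σ₂ = preferring P2 Descend

    -- double k = 2k, the index of the k-th Player-1 position of a play.
    double : ℕ → ℕ
    double zero = zero
    double (suc k) = suc (suc (double k))

    module Infinite (s₀ : S) (reachable : PostStarI₀ s₀) (own₀ : V₁ s₀)
      (σ₁ : Strategy P1) (π : ℕ → S) (play : InfinitePlay s₀ σ₁ σ₂ π)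
      (avoids : ¬ ∃ λ n → F (π n)) where
      open Follow σ₁ σ₂ π (λ n → proj₂ (proj₂ play n))

      moves : ∀ n → π n ⟶ π (suc n)
      moves n = step n (proj₂ (along (λ _ → ⊤) (λ n _ → proj₁ (proj₂ play n)) _ tt n))
                  (proj₁ (proj₂ play n))

      from-s₀ : ∀ n → s₀ ⟶* π n
      from-s₀ zero = subst (s₀ ⟶*_) (sym (proj₁ play)) ε
      from-s₀ (suc n) = from-s₀ n ◅◅ (moves n ◅ ε)

      in-A : ∀ n → A (π n)
      in-A n = star-closed A L2 (L1 _ (proj₁ (proj₂ reachable))) (proj₂ (proj₂ reachable) ◅◅ from-s₀ n)

      even-P1 : ∀ k → owner (π (double k)) ≡ P1
      even-P2 : ∀ k → owner (π (suc (double k))) ≡ P2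
      even-P1 zero = subst (λ x → owner x ≡ P1) (sym (proj₁ play)) own₀
      even-P1 (suc k) = ≢P2⇒≡P1 (proj₂ a0 (owned-move P2 (even-P2 k) (moves (suc (double k)))))
      even-P2 k = ≢P1⇒≡P2 (proj₁ a0 (owned-move P1 (even-P1 k) (moves (double k))))

      -- Each round, L4 provides a descending move, so σ₂ descends.
      descends : ∀ k → π (double (suc k)) ≺ π (double k)
      descends k = subst₂ _≺_ (sym played) last≡ (proj₂ descend)
        where
        x y : S
        x = π (double k)
        y = π (suc (double k))

        h : List S
        h = hist π (suc (double k))

        last≡ : lastOr y h ≡ x
        last≡ = trans (cong (lastOr y) (hist-suc π (double k))) (lastOr-snoc y (hist π (double k)) x)

        descend : Descend h y (preferred P2 Descend h y)
        descend with L4 x y (in-A (double k)) (λ f → avoids (_ , f)) (λ f → avoids (_ , f))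
                        (owned-move P1 (even-P1 k) (moves (double k)))
        ... | z , z∈A , y⟶z , z≺x =
          preferred-good P2 Descend h y (z , y⟶z , z∈A , subst (z ≺_) (sym last≡) z≺x)

        played : π (double (suc k)) ≡ preferred P2 Descend h y
        played = trans (proj₂ (proj₂ play (suc (double k)))) (next-P2 σ₁ σ₂ h y (even-P2 k))

      impossible : ⊥
      impossible = no-descent-in-finite irr tr (proj₁ (fin s₀)) (λ k → π (double k))
        (λ k → proj₂ (fin s₀) _ (from-s₀ (double k))) descends

    win : WinsReachable
    win = σ₂ , λ s₀ (reachable , own₀) σ₁ →
      (λ π play → classical _ (Infinite.impossible s₀ reachable own₀ σ₁ π play)) ,
      finite-plays-won a2

  -- Attr n x: Player 2 can force a visit to F from x within n moves
  -- (the n-th level of Player 2's attractor of F).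
  Attr : ℕ → S → Set
  Attr zero x = F x
  Attr (suc n) x = Attr n x
    ⊎ (V₂ x × ∃ λ y → (x ⟶₂ y) × Attr n y)
    ⊎ (V₁ x × (∀ y → x ⟶₁ y → Attr n y))

  Attr-mono : ∀ {n m x} → n ≤ m → Attr n x → Attr m x
  Attr-mono {zero} {zero} _ a = a
  Attr-mono {zero} {suc m} _ a = inj₁ (Attr-mono {zero} {m} z≤n a)
  Attr-mono (s≤s n≤m) (inj₁ a) = inj₁ (Attr-mono n≤m a)
  Attr-mono (s≤s n≤m) (inj₂ (inj₁ (own , y , m , a))) = inj₂ (inj₁ (own , y , m , Attr-mono n≤m a))
  Attr-mono (s≤s n≤m) (inj₂ (inj₂ (own , all))) = inj₂ (inj₂ (own , λ y m → Attr-mono n≤m (all y m)))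

  _⊏_ : S → S → Set
  z ⊏ x = ∃ λ n → Attr n z × ¬ Attr n x

  ⊏-irreflexive : Irreflexive _≡_ _⊏_
  ⊏-irreflexive refl (n , a , ¬a) = ¬a a

  ⊏-transitive : Transitive _⊏_
  ⊏-transitive (n , az , ¬ay) (m , ay , ¬ax) with n ≤? m
  ... | yes n≤m = m , Attr-mono n≤m az , ¬ax
  ... | no n≰m = ⊥-elim (¬ay (Attr-mono (<⇒≤ (≰⇒> n≰m)) ay))

  attracted-V₂ : ∀ k y → V₂ y → ¬ F y → Attr k y →
    ∃ λ j → j < k × ∃ λ z → (y ⟶₂ z) × Attr j z
  attracted-V₂ zero y own notF a = ⊥-elim (notF a)
  attracted-V₂ (suc k) y own notF (inj₁ a) with attracted-V₂ k y own notF a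
  ... | j , j<k , rest = j , m<n⇒m<1+n j<k , rest
  attracted-V₂ (suc k) y own notF (inj₂ (inj₁ (_ , z , m , a))) = k , n<1+n k , z , m , a
  attracted-V₂ (suc k) y own notF (inj₂ (inj₂ (own₁ , _))) = ⊥-elim (P1≢P2 (trans (sym own₁) own))

  attracted-V₁ : ∀ m x → V₁ x → ¬ F x → Attr m x → (∀ k → k < m → ¬ Attr k x) →
    ∃ λ m′ → m ≡ suc m′ × (∀ y → x ⟶₁ y → Attr m′ y)
  attracted-V₁ zero x own notF a _ = ⊥-elim (notF a)
  attracted-V₁ (suc m) x own notF (inj₁ a) minimal = ⊥-elim (minimal m (n<1+n m) a)
  attracted-V₁ (suc m) x own notF (inj₂ (inj₁ (own₂ , _))) _ = ⊥-elim (P1≢P2 (trans (sym own) own₂))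
  attracted-V₁ (suc m) x own notF (inj₂ (inj₂ (_ , all))) _ = m , refl , all

  attractor-descends : A0 → ∀ x y → (∃ λ n → Attr n x) → ¬ F x → ¬ F y → x ⟶₁ y →
    ∃ λ z → (y ⟶₂ z) × (z ⊏ x)
  attractor-descends a0 x y (n , a) notFx notFy x⟶y
    with least-witness lem (λ k → Attr k x) n a
  ... | m , am , minimal
    with attracted-V₁ m x (pre₁ x⟶y) notFx am minimal
  ... | m′ , refl , all
    with attracted-V₂ m′ y (≢P1⇒≡P2 (proj₁ a0 x⟶y)) notFy (all y x⟶y)
  ... | j , j<m′ , z , y⟶z , az = z , y⟶z , j , az , minimal j (m<n⇒m<1+n j<m′)

  Out : S → Set
  Out s = ∀ n → ¬ Attr n s

  module Necessity (fin : ImageFinite) (a2 : A2) where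

    common-level : (Q : S → Set) (ys : List S) → (∀ y → y ∈ ys → Q y → ∃ λ n → Attr n y) →
      ∃ λ N → ∀ y → y ∈ ys → Q y → Attr N y
    common-level Q [] _ = zero , λ y ()
    common-level Q (y ∷ ys) levels
      with common-level Q ys (λ y′ y′∈ys → levels y′ (there y′∈ys)) | lem {Q y}
    ... | N , atN | no ¬qy = N , λ { _ (here refl) qy → ⊥-elim (¬qy qy)
                                    ; y′ (there y′∈ys) → atN y′ y′∈ys }
    ... | N , atN | yes qy with levels y (here refl) qy
    ...   | n , atn = n ⊔ N , λ { _ (here refl) _ → Attr-mono (m≤m⊔n n N) atn
                               ; y′ (there y′∈ys) qy′ → Attr-mono (m≤n⊔m n N) (atN y′ y′∈ys qy′) }

    -- A Player-1 configuration outside the attractor has a successor outside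
    -- it: otherwise its finitely many successors share a level N and the
    -- configuration itself would be at level N + 1.
    escape : ∀ p → V₁ p → Out p → ∃ λ y → (p ⟶₁ y) × Out y
    escape p own out = classical _ λ noEscape →
      let successors : List S
          successors = proj₁ (fin p)
          levels : ∀ y → y ∈ successors → p ⟶₁ y → ∃ λ n → Attr n y
          levels y _ m = classical _ (λ unattracted → noEscape (y , m , λ n a → unattracted (n , a)))
          N , atN = common-level (p ⟶₁_) successors levels
      in out (suc N) (inj₂ (inj₂ (own , λ y m → atN y (proj₂ (fin p) y (inj₁ m ◅ ε)) m)))

    Stay : List S → S → S → Set
    Stay _ _ = Out

    σ₁ : Strategy P1
    σ₁ = preferring P1 Stay

    module Spoil (σ₂ : Strategy P2) (s₀ : S) (out₀ : Out s₀) where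
      build : ℕ → List S × S
      build zero = [] , s₀
      build (suc n) with build n
      ... | h , p = h ++ [ p ] , next σ₁ σ₂ h p

      π : ℕ → S
      π n = proj₂ (build n)

      build-hist : ∀ n → proj₁ (build n) ≡ hist π n
      build-hist zero = refl
      build-hist (suc n) = trans (cong (_++ [ π n ]) (build-hist n)) (sym (hist-suc π n))

      follows : ∀ n → π (suc n) ≡ next σ₁ σ₂ (hist π n) (π n)
      follows n = cong (λ h → next σ₁ σ₂ h (π n)) (build-hist n)

      open Follow σ₁ σ₂ π follows

      stays-out : ∀ n → Out (π n) → π n ⟶ π (suc n) → Out (π (suc n))
      stays-out n out m with owner-cases (π n)
      ... | inj₁ own = subst Out (sym (trans (follows n) (next-P1 σ₁ σ₂ _ _ own)))
                   (preferred-good P1 Stay (hist π n) (π n) (escape (π n) own out))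
      ... | inj₂ own = λ k a → out (suc k) (inj₂ (inj₁ (own , π (suc n) , owned-move P2 own m , a)))

      outside : ∀ n → Out (π n)
      outside n = proj₁ (along (λ n → Out (π n))
        (λ n out dead → dead (a2 (π n) (out zero))) stays-out out₀ n)

      play : InfinitePlay s₀ σ₁ σ₂ π
      play = refl , λ n → (λ dead → dead (a2 (π n) (outside n zero))) , follows n

    winning⇒attracted : WinsReachable → ∀ x → PostStarI₀ x → V₁ x → ∃ λ n → Attr n x
    winning⇒attracted (σ₂ , wins) x reachable own = classical _ λ unattracted →
      let out₀ : Out x
          out₀ n a = unattracted (n , a)
          n , visitsF = proj₁ (wins x (reachable , own) σ₁) (Spoil.π σ₂ x out₀) (Spoil.play σ₂ x out₀)
      in Spoil.outside σ₂ x out₀ n zero visitsF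

  Certificate : Set₁
  Certificate = Σ (S → Set) λ A → Σ (S → S → Set) λ _≺_ →
    (∀ s → I₀ s → A s) ×
    (∀ x y → A x → (x ⟶₁ y) ⊎ (x ⟶₂ y) → A y) ×
    (Irreflexive _≡_ _≺_ × Transitive _≺_) ×
    (∀ x y → A x → ¬ F x → ¬ F y → x ⟶₁ y → ∃ λ z → A z × (y ⟶₂ z) × (z ≺ x))

  necessary : ImageFinite → A0 → A2 → WinsReachable → Certificate
  necessary fin a0 a2 wins =
    PostStarI₀ , _⊏_ , (λ s s∈I₀ → s , s∈I₀ , ε) , post-closed , (⊏-irreflexive , ⊏-transitive) , L4
    where
    L4 : ∀ x y → PostStarI₀ x → ¬ F x → ¬ F y → x ⟶₁ y →
      ∃ λ z → PostStarI₀ z × (y ⟶₂ z) × (z ⊏ x)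
    L4 x y reachable notFx notFy x⟶y
      with attractor-descends a0 x y
             (Necessity.winning⇒attracted fin a2 wins x reachable (pre₁ x⟶y)) notFx notFy x⟶y
    ... | z , y⟶z , z⊏x =
      z , post-closed y z (post-closed x y reachable (inj₁ x⟶y)) (inj₂ y⟶z) , y⟶z , z⊏x

  sufficient : ImageFinite → A0 → A2 → Certificate → WinsReachable
  sufficient fin a0 a2 (A , _≺_ , L1 , L2 , (irr , tr) , L4) =
    Sufficiency.win fin a0 a2 A _≺_ L1 L2 irr tr L4

mainTheorem1 : ExcludedMiddle 0ℓ →
    (G : Arena) (I₀ F : Arena.S G → Set) →
    let open Game G I₀ F in
    ImageFinite → A0 → A1 → A2 →
    HasWinningStrategy₂ (λ s → PostStarI₀ s × V₁ s)
    ⇔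
    (Σ (S → Set) λ A → Σ (S → S → Set) λ _≺_ →
    (∀ s → I₀ s → A s) ×
    (∀ x y → A x → (x ⟶₁ y) ⊎ (x ⟶₂ y) → A y) ×
    (Irreflexive _≡_ _≺_ × Transitive _≺_) ×
    (∀ x y → A x → ¬ F x → ¬ F y → x ⟶₁ y →
    ∃ λ z → A z × (y ⟶₂ z) × (z ≺ x)))
-- Both directions.
mainTheorem1 lem G I₀ F fin a0 _ a2 = mk⇔ (necessary fin a0 a2) (sufficient fin a0 a2)
  where open Theory lem G I₀ F
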